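{- For every integer $n>5$, there exist two complete games of the Fibonacci Quilt Game on $n$ with different numbers of moves; moreover, there is always a complete game with an odd number of moves and a complete game with an even number of moves.
   Context: Let $(q_i)_{i\ge1}$ be the Fibonacci Quilt sequence: $q_1=1,q_2=2,q_3=3,q_4=4$ and $q_i=q_{i-3}+q_{i-2}$ for $i\ge5$. The Fibonacci Quilt Game on $n$: a position is a finite multiset of terms $q_i$ (recorded by their indices); the initial position is $n$ copies of $q_1$. A move replaces two elements of the current multiset (with multiplicity) by one or two elements according to one of the following rules: (1a) $q_1,q_2\to q_3$; (1b) for $i\ge2$, $q_i,q_{i+1}\to q_{i+3}$; (2a) $q_1,q_5\to q_2,q_4$, allowed only if no other move is possible in the current position; (2b) for $i\ge2$, $q_i,q_{i+4}\to q_{i+5}$; (3a) $q_1,q_1\to q_2$; (3b) $q_2,q_2\to q_4$; (3c) $q_3,q_3\to q_2,q_4$; (3d) $q_4,q_4\to q_1,q_6$ or $q_4,q_4\to q_3,q_5$ (player's choice); (3e) $q_5,q_5\to q_1,q_7$; (3f) $q_6,q_6\to q_2,q_8$ or $q_6,q_6\to q_3,q_7$ (player's choice); (3g) for $i\ge7$, $q_i,q_i\to q_{i-5},q_{i+2}$; (4a) for $i=1,2$, $q_i,q_{i+3}\to q_{i+4}$; (4b) $q_3,q_6\to q_1,q_7$; (4c) for $i=4,5$, $q_i,q_{i+3}\to q_1,q_{i+4}$; (4d) $q_6,q_9\to q_2,q_{10}$; (4e) for $i\ge7$, $q_i,q_{i+3}\to q_{i-5},q_{i+4}$; (5) $q_1,q_3\to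 q_4$. A complete game is a sequence of legal moves from the initial position to a position in which no move is possible; its length is its number of moves. -}

module Defs where

open import Data.Nat using (ℕ; zero; suc; _+_; _*_; _∸_; _≤_)
open import Data.List using (List; []; _∷_; _++_; replicate)
open import Data.List.Relation.Binary.Permutation.Propositional using (_↭_)
open import Data.Product using (∃; ∃-syntax; _×_; _,_)
open import Relation.Nullary using (¬_)
open import Relation.Binary.PropositionalEquality using (_≡_)

-- A position is a finite multiset of Fibonacci Quilt terms q_i, recorded by
-- their indices i (≥ 1).  Multisets are lists considered up to permutation (_↭_).
Position : Set
Position = List ℕ

-- Ordinary rules (every rule except (2a)):  Rule a b out  means the move
-- q_a , q_b → out  is an instance of one of the rules.
data Rule : ℕ → ℕ → List ℕ → Set where
  r1a  : Rule 1 2 (3 ∷ [])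
  r1b  : ∀ i → 2 ≤ i → Rule i (i + 1) (i + 3 ∷ [])
  r2b  : ∀ i → 2 ≤ i → Rule i (i + 4) (i + 5 ∷ [])
  r3a  : Rule 1 1 (2 ∷ [])
  r3b  : Rule 2 2 (4 ∷ [])
  r3c  : Rule 3 3 (2 ∷ 4 ∷ [])
  r3d₁ : Rule 4 4 (1 ∷ 6 ∷ [])
  r3d₂ : Rule 4 4 (3 ∷ 5 ∷ [])
  r3e  : Rule 5 5 (1 ∷ 7 ∷ [])
  r3f₁ : Rule 6 6 (2 ∷ 8 ∷ [])
  r3f₂ : Rule 6 6 (3 ∷ 7 ∷ [])
  r3g  : ∀ i → 7 ≤ i → Rule i i (i ∸ 5 ∷ i + 2 ∷ [])
  r4a  : ∀ i → 1 ≤ i → i ≤ 2 → Rule i (i + 3) (i + 4 ∷ [])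
  r4b  : Rule 3 6 (1 ∷ 7 ∷ [])
  r4c  : ∀ i → 4 ≤ i → i ≤ 5 → Rule i (i + 3) (1 ∷ i + 4 ∷ [])
  r4d  : Rule 6 9 (2 ∷ 10 ∷ [])
  r4e  : ∀ i → 7 ≤ i → Rule i (i + 3) (i ∸ 5 ∷ i + 4 ∷ [])
  r5   : Rule 1 3 (4 ∷ [])

data OrdinaryMove (p q : Position) : Set where
  ordinary : ∀ a b out rest → p ↭ (a ∷ b ∷ rest) → Rule a b out →
             q ↭ (out ++ rest) → OrdinaryMove p q

data Move (p q : Position) : Set where
  ord   : OrdinaryMove p q → Move p q
  rule2a : ∀ rest → p ↭ (1 ∷ 5 ∷ rest) → q ↭ (2 ∷ 4 ∷ rest) →
           (¬ (∃[ q' ] OrdinaryMove p q')) → Move p q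

Terminal : Position → Set
Terminal p = ¬ (∃[ q ] Move p q)

data CompleteFrom : Position → ℕ → Set where
  done : ∀ {p} → Terminal p → CompleteFrom p 0
  step : ∀ {p q k} → Move p q → CompleteFrom q k → CompleteFrom p (suc k)

initial : ℕ → Position
initial n = replicate n 1

CompleteGame : ℕ → ℕ → Set
CompleteGame n k = CompleteFrom (initial n) k

IsEven IsOdd : ℕ → Set
IsEven k = ∃[ m ] k ≡ 2 * m
IsOdd  k = ∃[ m ] k ≡ 2 * m + 1

module Submission where

-- 1. Termination.  A potential `Weight` (a sum of per-index weights) strictly
--    decreases under every legal move, so no game is infinite.
-- 2. Decidability.  The ordinary rules apply exactly to the `Combinable`
--    pairs, a decidable relation; picking a pair out of a finite multiset is
--    decidable, hence so is "some move is possible".  Together with 1 this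
--    gives: from every position there is a complete game (`complete-game`).
-- 3. Two openings.  From six copies of q₁ (plus any remainder R) the position
--    q₄ , q₂ , R is reached both in 4 and in 5 moves.
-- For n = 6 + m we complete the game from q₄ , q₂ , q₁^m in some k moves and
-- prepend either opening, obtaining complete games of lengths 4 + k and 5 + k.

open import Defs
open import Data.Nat using (ℕ; _<_)
open import Data.Product using (∃-syntax; _×_)
open import Relation.Binary.PropositionalEquality using (_≢_)

open import Data.Nat using (zero; suc; _+_; _*_; _∸_; _≤_; _<ᵇ_; s≤s; z≤n; _≟_; _≤?_)
open import Data.Nat.Properties using (module ≤-Reasoning; <ᵇ⇒<; m≤m+n; +-monoˡ-<; +-comm; 1+n≢n; ≤-trans)
open import Data.Nat.ListAction using (sum)
open import Data.Nat.ListAction.Properties using (sum-↭; sum-++)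
open import Data.Nat.Tactic.RingSolver using (solve-∀)
open import Data.Nat.Induction using (<-wellFounded)
open import Induction.WellFounded using (Acc; acc)
open import Data.List using (List; []; _∷_; _++_; replicate; map)
open import Data.List.Properties using (map-++)
open import Data.List.Relation.Binary.Permutation.Propositional
  using (_↭_; refl; prep; swap; trans; ↭-sym)
open import Data.List.Relation.Binary.Permutation.Propositional.Properties
  using (∈-resp-↭; drop-∷; shift; map⁺)
open import Data.List.Membership.Propositional using (_∈_)
open import Data.List.Relation.Unary.Any using (here; there)
open import Data.Product using (∃; _,_; proj₁; proj₂)
open import Data.Sum using (_⊎_; inj₁; inj₂)
open import Data.Bool using (T)
open import Relation.Nullary using (Dec; yes; no)
open import Relation.Nullary.Decidable using (_×-dec_)
open import Relation.Binary.PropositionalEquality using (_≡_; refl; sym; cong; module ≡-Reasoning)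

by-eval : ∀ {m n} {ok : T (m <ᵇ n)} → m < n
by-eval {m} {n} {ok} = <ᵇ⇒< m n ok

<-by-margin : ∀ {x y} d → x ≡ suc (y + d) → y < x
<-by-margin {y = y} d refl = s≤s (m≤m+n y d)

-- For i ≥ 6 the weight is 4i + 7; the values at 1..5 are raised above that
-- line just enough for the rules with small indices to lose weight too.
weight : ℕ → ℕ
weight 0 = 0
weight 1 = 11
weight 2 = 16
weight 3 = 24
weight 4 = 31
weight 5 = 37
weight (suc (suc (suc (suc (suc (suc j)))))) = 31 + 4 * j

Weight : Position → ℕ
Weight p = sum (map weight p)

Weight-↭ : ∀ {p q} → p ↭ q → Weight p ≡ Weight q
Weight-↭ σ = sum-↭ (map⁺ weight σ)

Weight-++ : ∀ p q → Weight (p ++ q) ≡ Weight p + Weight q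
Weight-++ p q = begin
  sum (map weight (p ++ q))             ≡⟨ cong sum (map-++ weight p q) ⟩
  sum (map weight p ++ map weight q)    ≡⟨ sum-++ (map weight p) (map weight q) ⟩
  Weight p + Weight q                   ∎
  where open ≡-Reasoning

-- The four families of rules with an unbounded index, written with the index
-- as an offset j from its least admissible value.  Small offsets are checked
-- by evaluation; from index 6 on the weight is linear and a ring identity
-- exhibits the margin.
next-decreases : ∀ j → Weight (2 + j + 3 ∷ []) < Weight (2 + j ∷ 2 + j + 1 ∷ [])
next-decreases 0 = by-eval
next-decreases 1 = by-eval
next-decreases 2 = by-eval
next-decreases 3 = by-eval
next-decreases (suc (suc (suc (suc j)))) = <-by-margin (22 + 4 * j) (margin j)
  where
  margin : ∀ j → (31 + 4 * j) + (31 + 4 * (j + 1) + 0) ≡ suc (31 + 4 * (j + 3) + 0 + (22 + 4 * j))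
  margin = solve-∀

skip4-decreases : ∀ j → Weight (2 + j + 5 ∷ []) < Weight (2 + j ∷ 2 + j + 4 ∷ [])
skip4-decreases 0 = by-eval
skip4-decreases 1 = by-eval
skip4-decreases 2 = by-eval
skip4-decreases 3 = by-eval
skip4-decreases (suc (suc (suc (suc j)))) = <-by-margin (26 + 4 * j) (margin j)
  where
  margin : ∀ j → (31 + 4 * j) + (31 + 4 * (j + 4) + 0) ≡ suc (31 + 4 * (j + 5) + 0 + (26 + 4 * j))
  margin = solve-∀

double-decreases : ∀ j → Weight (7 + j ∸ 5 ∷ 7 + j + 2 ∷ []) < Weight (7 + j ∷ 7 + j ∷ [])
double-decreases 0 = by-eval
double-decreases 1 = by-eval
double-decreases 2 = by-eval
double-decreases 3 = by-eval
double-decreases (suc (suc (suc (suc j)))) = <-by-margin 11 (margin j)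
  where
  margin : ∀ j → (31 + 4 * (5 + j)) + (31 + 4 * (5 + j) + 0) ≡ suc ((31 + 4 * j) + (31 + 4 * (5 + (j + 2)) + 0) + 11)
  margin = solve-∀

skip3-decreases : ∀ j → Weight (7 + j ∸ 5 ∷ 7 + j + 4 ∷ []) < Weight (7 + j ∷ 7 + j + 3 ∷ [])
skip3-decreases 0 = by-eval
skip3-decreases 1 = by-eval
skip3-decreases 2 = by-eval
skip3-decreases 3 = by-eval
skip3-decreases (suc (suc (suc (suc j)))) = <-by-margin 15 (margin j)
  where
  margin : ∀ j → (31 + 4 * (5 + j)) + (31 + 4 * (5 + (j + 3)) + 0) ≡ suc ((31 + 4 * j) + (31 + 4 * (5 + (j + 4)) + 0) + 15)
  margin = solve-∀

rule-decreases : ∀ {a b out} → Rule a b out → Weight out < Weight (a ∷ b ∷ [])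
rule-decreases r1a = by-eval
rule-decreases (r1b _ (s≤s (s≤s {n = j} _))) = next-decreases j
rule-decreases (r2b _ (s≤s (s≤s {n = j} _))) = skip4-decreases j
rule-decreases r3a = by-eval
rule-decreases r3b = by-eval
rule-decreases r3c = by-eval
rule-decreases r3d₁ = by-eval
rule-decreases r3d₂ = by-eval
rule-decreases r3e = by-eval
rule-decreases r3f₁ = by-eval
rule-decreases r3f₂ = by-eval
rule-decreases (r3g _ (s≤s (s≤s (s≤s (s≤s (s≤s (s≤s (s≤s {n = j} _)))))))) = double-decreases j
rule-decreases (r4a 1 _ _) = by-eval
rule-decreases (r4a 2 _ _) = by-eval
rule-decreases (r4a (suc (suc (suc _))) _ (s≤s (s≤s ())))
rule-decreases r4b = by-eval
rule-decreases (r4c 1 (s≤s ()) _)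
rule-decreases (r4c 2 (s≤s (s≤s ())) _)
rule-decreases (r4c 3 (s≤s (s≤s (s≤s ()))) _)
rule-decreases (r4c 4 _ _) = by-eval
rule-decreases (r4c 5 _ _) = by-eval
rule-decreases (r4c (suc (suc (suc (suc (suc (suc _)))))) _ (s≤s (s≤s (s≤s (s≤s (s≤s ()))))))
rule-decreases r4d = by-eval
rule-decreases (r4e _ (s≤s (s≤s (s≤s (s≤s (s≤s (s≤s (s≤s {n = j} _)))))))) = skip3-decreases j
rule-decreases r5 = by-eval

replace-decreases : ∀ {p q consumed produced rest} →
  p ↭ consumed ++ rest → q ↭ produced ++ rest →
  Weight produced < Weight consumed → Weight q < Weight p
replace-decreases {p} {q} {consumed} {produced} {rest} σ τ lighter = begin-strict
  Weight q                        ≡⟨ Weight-↭ τ ⟩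
  Weight (produced ++ rest)       ≡⟨ Weight-++ produced rest ⟩
  Weight produced + Weight rest   <⟨ +-monoˡ-< (Weight rest) lighter ⟩
  Weight consumed + Weight rest   ≡⟨ Weight-++ consumed rest ⟨
  Weight (consumed ++ rest)       ≡⟨ Weight-↭ σ ⟨
  Weight p                        ∎
  where open ≤-Reasoning

move-decreases : ∀ {p q} → Move p q → Weight q < Weight p
move-decreases (ord (ordinary a b out rest σ r τ)) =
  replace-decreases {consumed = a ∷ b ∷ []} {produced = out} σ τ (rule-decreases r)
move-decreases (rule2a rest σ τ _) =
  replace-decreases {consumed = 1 ∷ 5 ∷ []} {produced = 2 ∷ 4 ∷ []} σ τ by-eval

data Combinable : ℕ → ℕ → Set where
  with-q₁ : ∀ {b} → 1 ≤ b → b ≤ 4 → Combinable 1 b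
  equal   : ∀ {a} → 2 ≤ a → Combinable a a
  gap1    : ∀ {a} → 2 ≤ a → Combinable a (a + 1)
  gap3    : ∀ {a} → 2 ≤ a → Combinable a (a + 3)
  gap4    : ∀ {a} → 2 ≤ a → Combinable a (a + 4)

rule-combinable : ∀ {a b out} → Rule a b out → Combinable a b
rule-combinable r1a = with-q₁ (s≤s z≤n) by-eval
rule-combinable (r1b _ h) = gap1 h
rule-combinable (r2b _ h) = gap4 h
rule-combinable r3a = with-q₁ (s≤s z≤n) by-eval
rule-combinable r3b = equal by-eval
rule-combinable r3c = equal by-eval
rule-combinable r3d₁ = equal by-eval
rule-combinable r3d₂ = equal by-eval
rule-combinable r3e = equal by-eval
rule-combinable r3f₁ = equal by-eval
rule-combinable r3f₂ = equal by-eval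
rule-combinable (r3g _ h) = equal (≤-trans by-eval h)
rule-combinable (r4a 1 _ _) = with-q₁ (s≤s z≤n) by-eval
rule-combinable (r4a 2 _ _) = gap3 by-eval
rule-combinable (r4a (suc (suc (suc _))) _ (s≤s (s≤s ())))
rule-combinable r4b = gap3 by-eval
rule-combinable (r4c _ h _) = gap3 (≤-trans by-eval h)
rule-combinable r4d = gap3 by-eval
rule-combinable (r4e _ h) = gap3 (≤-trans by-eval h)
rule-combinable r5 = with-q₁ (s≤s z≤n) by-eval

combinable-rule : ∀ {a b} → Combinable a b → ∃ (Rule a b)
combinable-rule (with-q₁ lower upper) = with-q₁-rule lower upper
  where
  with-q₁-rule : ∀ {b} → 1 ≤ b → b ≤ 4 → ∃ (Rule 1 b)
  with-q₁-rule {1} _ _ = _ , r3a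
  with-q₁-rule {2} _ _ = _ , r1a
  with-q₁-rule {3} _ _ = _ , r5
  with-q₁-rule {4} _ _ = _ , r4a 1 by-eval by-eval
  with-q₁-rule {suc (suc (suc (suc (suc _))))} _ (s≤s (s≤s (s≤s (s≤s ()))))
combinable-rule (equal h) = equal-rule h
  where
  equal-rule : ∀ {a} → 2 ≤ a → ∃ (Rule a a)
  equal-rule {1} (s≤s ())
  equal-rule {2} _ = _ , r3b
  equal-rule {3} _ = _ , r3c
  equal-rule {4} _ = _ , r3d₁
  equal-rule {5} _ = _ , r3e
  equal-rule {6} _ = _ , r3f₁
  equal-rule {suc (suc (suc (suc (suc (suc (suc j))))))} _ = _ , r3g (7 + j) (s≤s (s≤s (s≤s (s≤s (s≤s (s≤s (s≤s z≤n)))))))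
combinable-rule (gap1 h) = _ , r1b _ h
combinable-rule (gap3 h) = gap3-rule h
  where
  gap3-rule : ∀ {a} → 2 ≤ a → ∃ (Rule a (a + 3))
  gap3-rule {1} (s≤s ())
  gap3-rule {2} _ = _ , r4a 2 by-eval by-eval
  gap3-rule {3} _ = _ , r4b
  gap3-rule {4} _ = _ , r4c 4 by-eval by-eval
  gap3-rule {5} _ = _ , r4c 5 by-eval by-eval
  gap3-rule {6} _ = _ , r4d
  gap3-rule {suc (suc (suc (suc (suc (suc (suc j))))))} _ = _ , r4e (7 + j) (s≤s (s≤s (s≤s (s≤s (s≤s (s≤s (s≤s z≤n)))))))
combinable-rule (gap4 h) = _ , r2b _ h

combinable? : ∀ a b → Dec (Combinable a b)
combinable? 0 b = no λ { (equal ()) ; (gap1 ()) ; (gap3 ()) ; (gap4 ()) }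
combinable? 1 b with 1 ≤? b ×-dec b ≤? 4
... | yes (lower , upper) = yes (with-q₁ lower upper)
... | no out-of-range = no λ { (with-q₁ lower upper) → out-of-range (lower , upper)
                             ; (equal (s≤s ())) ; (gap1 (s≤s ())) ; (gap3 (s≤s ())) ; (gap4 (s≤s ())) }
combinable? (suc (suc a)) b with b ≟ 2 + a | b ≟ 2 + a + 1 | b ≟ 2 + a + 3 | b ≟ 2 + a + 4
... | yes refl | _ | _ | _ = yes (equal (s≤s (s≤s z≤n)))
... | _ | yes refl | _ | _ = yes (gap1 (s≤s (s≤s z≤n)))
... | _ | _ | yes refl | _ = yes (gap3 (s≤s (s≤s z≤n)))
... | _ | _ | _ | yes refl = yes (gap4 (s≤s (s≤s z≤n)))
... | no ≢a | no ≢a+1 | no ≢a+3 | no ≢a+4 =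
  no λ { (equal _) → ≢a refl ; (gap1 _) → ≢a+1 refl ; (gap3 _) → ≢a+3 refl ; (gap4 _) → ≢a+4 refl }

module _ {A : Set} where

  data Pick : A → List A → List A → Set where
    pick-head : ∀ {x xs} → Pick x xs (x ∷ xs)
    pick-tail : ∀ {x rest y xs} → Pick x rest xs → Pick x (y ∷ rest) (y ∷ xs)

  pick-↭ : ∀ {x rest xs} → Pick x rest xs → xs ↭ x ∷ rest
  pick-↭ pick-head = refl
  pick-↭ (pick-tail {x} {rest} {y} picked) = trans (prep y (pick-↭ picked)) (swap y x refl)

  ∈-pick : ∀ {x xs} → x ∈ xs → ∃ λ rest → Pick x rest xs
  ∈-pick (here refl) = _ , pick-head
  ∈-pick (there x∈xs) with ∈-pick x∈xs
  ... | rest , picked = _ , pick-tail picked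

  -- Whether some element can be picked so that it and the remainder satisfy
  -- P; after skipping the head, the head must be put back into the remainder.
  pick? : (P : A → List A → Set) → (∀ x rest → Dec (P x rest)) → ∀ xs →
          Dec (∃ λ x → ∃ λ rest → Pick x rest xs × P x rest)
  pick? P P? [] = no λ { (_ , _ , () , _) }
  pick? P P? (y ∷ xs) with P? y xs | pick? (λ x rest → P x (y ∷ rest)) (λ x rest → P? x (y ∷ rest)) xs
  ... | yes p | _ = yes (y , xs , pick-head , p)
  ... | no _ | yes (x , rest , picked , p) = yes (x , y ∷ rest , pick-tail picked , p)
  ... | no ¬head | no ¬tail =
    no λ { (_ , _ , pick-head , p) → ¬head p ; (x , _ , pick-tail picked , p) → ¬tail (x , _ , picked , p) }

  HasPair : (A → A → Set) → List A → Set
  HasPair R xs = ∃ λ a → ∃ λ b → ∃ λ rest → (xs ↭ a ∷ b ∷ rest) × R a b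

  has-pair? : (R : A → A → Set) → (∀ a b → Dec (R a b)) → ∀ xs → Dec (HasPair R xs)
  has-pair? R R? xs with pick? (λ a rest → ∃ λ b → ∃ λ rest′ → Pick b rest′ rest × R a b)
                               (λ a rest → pick? (λ b _ → R a b) (λ b _ → R? a b) rest) xs
  ... | yes (a , rest , picked-a , b , rest′ , picked-b , r) =
    yes (a , b , rest′ , trans (pick-↭ picked-a) (prep a (pick-↭ picked-b)) , r)
  ... | no none = no λ (a , b , rest , σ , r) → none (picks σ r)
    where
    picks : ∀ {a b rest} → xs ↭ a ∷ b ∷ rest → R a b →
            ∃ λ a → ∃ λ rest₁ → Pick a rest₁ xs × ∃ λ b → ∃ λ rest₂ → Pick b rest₂ rest₁ × R a b
    picks {a} {b} σ r with ∈-pick (∈-resp-↭ (↭-sym σ) (here refl))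
    ... | rest₁ , picked-a with ∈-pick (∈-resp-↭ (↭-sym (drop-∷ (trans (↭-sym (pick-↭ picked-a)) σ))) (here refl))
    ...   | rest₂ , picked-b = a , rest₁ , picked-a , b , rest₂ , picked-b , r

ordinary-move? : ∀ p → Dec (∃ (OrdinaryMove p))
ordinary-move? p with has-pair? Combinable combinable? p
... | yes (a , b , rest , σ , c) with combinable-rule c
...   | out , r = yes (out ++ rest , ordinary a b out rest σ r refl)
ordinary-move? p | no ¬pair =
  no λ { (_ , ordinary a b out rest σ r _) → ¬pair (a , b , rest , σ , rule-combinable r) }

IsRule2a : ℕ → ℕ → Set
IsRule2a a b = a ≡ 1 × b ≡ 5

move-or-terminal : ∀ p → ∃ (Move p) ⊎ Terminal p
move-or-terminal p with ordinary-move? p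
... | yes (q , m) = inj₁ (q , ord m)
... | no ¬ordinary with has-pair? IsRule2a (λ a b → a ≟ 1 ×-dec b ≟ 5) p
...   | yes (_ , _ , rest , σ , refl , refl) = inj₁ (2 ∷ 4 ∷ rest , rule2a rest σ refl ¬ordinary)
...   | no ¬pair = inj₂ λ { (_ , ord m) → ¬ordinary (_ , m)
                          ; (_ , rule2a rest σ _ _) → ¬pair (1 , 5 , rest , σ , refl , refl) }

complete-game : ∀ p → ∃ (CompleteFrom p)
complete-game p = play p (<-wellFounded (Weight p))
  where
  play : ∀ p → Acc _<_ (Weight p) → ∃ (CompleteFrom p)
  play p (acc smaller) with move-or-terminal p
  ... | inj₂ terminal = 0 , done terminal
  ... | inj₁ (q , m) with play q (smaller (move-decreases m))
  ...   | k , game = suc k , step m game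

data Path : Position → Position → ℕ → Set where
  stay  : ∀ {p} → Path p p 0
  _▸_   : ∀ {p q r k} → Move p q → Path q r k → Path p r (suc k)

infixr 5 _▸_

extend : ∀ {p q k l} → Path p q k → CompleteFrom q l → CompleteFrom p (k + l)
extend stay game = game
extend (m ▸ path) game = step m (extend path game)

apply : ∀ {a b out rest p q} → p ↭ a ∷ b ∷ rest → Rule a b out → q ↭ out ++ rest → Move p q
apply σ r τ = ord (ordinary _ _ _ _ σ r τ)

-- q₁⁶ → q₁⁴ q₂ → q₁² q₂² → q₂³ → q₄ q₂ : rules 3a, 3a, 3a, 3b.
opening-4 : ∀ R → Path (1 ∷ 1 ∷ 1 ∷ 1 ∷ 1 ∷ 1 ∷ R) (4 ∷ 2 ∷ R) 4
opening-4 R =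
  apply refl r3a (shift 2 (1 ∷ 1 ∷ 1 ∷ 1 ∷ []) R) ▸
  apply refl r3a (shift 2 (1 ∷ 1 ∷ []) (2 ∷ R)) ▸
  apply refl r3a refl ▸
  apply refl r3b refl ▸
  stay

-- q₁⁶ → q₁ q₂ q₁³ → q₁² q₃ q₁ → q₁ q₂ q₃ → q₃² → q₄ q₂ : rules 3a, 1a, 3a, 1a, 3c.
opening-5 : ∀ R → Path (1 ∷ 1 ∷ 1 ∷ 1 ∷ 1 ∷ 1 ∷ R) (4 ∷ 2 ∷ R) 5
opening-5 R =
  apply refl r3a (swap 1 2 refl) ▸
  apply refl r1a (shift 3 (1 ∷ 1 ∷ []) (1 ∷ R)) ▸
  apply refl r3a (↭-sym (shift 1 (2 ∷ 3 ∷ []) R)) ▸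
  apply refl r1a refl ▸
  apply refl r3c (swap 4 2 refl) ▸
  stay

even-suc : ∀ {k} → IsOdd k → IsEven (suc k)
even-suc (m , refl) = suc m , lemma m
  where
  lemma : ∀ m → suc (2 * m + 1) ≡ 2 * suc m
  lemma = solve-∀

odd-suc : ∀ {k} → IsEven k → IsOdd (suc k)
odd-suc (m , refl) = m , +-comm 1 (2 * m)

even-or-odd : ∀ k → IsEven k ⊎ IsOdd k
even-or-odd zero = inj₁ (0 , refl)
even-or-odd (suc k) with even-or-odd k
... | inj₁ even = inj₂ (odd-suc even)
... | inj₂ odd = inj₁ (even-suc odd)

both-parities : ∀ {n k} → CompleteGame n k → CompleteGame n (suc k) →
  (∃[ l ] (CompleteGame n l × IsOdd l)) × (∃[ l ] (CompleteGame n l × IsEven l))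
both-parities {k = k} shorter longer with even-or-odd k
... | inj₁ even = (_ , longer , odd-suc even) , (_ , shorter , even)
... | inj₂ odd = (_ , shorter , odd) , (_ , longer , even-suc odd)

corollary2p5 : ∀ (n : ℕ) → 5 < n →
    (∃[ k ] ∃[ l ] (CompleteGame n k × CompleteGame n l × k ≢ l))
    × (∃[ k ] (CompleteGame n k × IsOdd k))
    × (∃[ k ] (CompleteGame n k × IsEven k))
corollary2p5 n (s≤s (s≤s (s≤s (s≤s (s≤s (s≤s {n = m} _)))))) =
  (4 + k , 5 + k , shorter , longer , λ eq → 1+n≢n (sym eq)) , both-parities shorter longer
  where
  ending : ∃ (CompleteFrom (4 ∷ 2 ∷ replicate m 1))
  ending = complete-game (4 ∷ 2 ∷ replicate m 1)

  k : ℕ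
  k = proj₁ ending

  shorter : CompleteGame n (4 + k)
  shorter = extend (opening-4 _) (proj₂ ending)

  longer : CompleteGame n (5 + k)
  longer = extend (opening-5 _) (proj₂ ending)
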